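{- Let $n$ be a positive integer and let $R_n=R_{n,n}$. Then $\lfloor\frac{n}{2}\rfloor$ lions do not suffice to clear $R_n$: for every initial placement of $\lfloor\frac{n}{2}\rfloor$ lions on vertices of $R_n$ and every sequence of (unrestricted) lion moves, there is no time $t$ with $C(t)=V(R_n)$.
   Context: For positive integers $n,l$, $R_{n,l}$ is the graph with vertex set $\{(i,j): 1\le i\le l,\ 1\le j\le n\}$ in which $(i,j)$ and $(i',j')$ are adjacent if and only if $(i'-i,j'-j)\in\{(\pm1,0),(0,\pm1),(1,-1),(-1,1)\}$ (a parallelogram/rhombus-shaped piece of the triangular lattice). Lions and contamination model: lions occupy vertices of a graph $G=(V,E)$ (several lions may share a vertex). Time is discrete, $t=0,1,2,\dots$. Between times $t$ and $t+1$ each lion either stays at its vertex or moves along an edge to an adjacent vertex. $C(t)\subseteq V$ denotes the set of cleared vertices at time $t$. $C(0)$ is the set of vertices occupied by lions at time $0$. For $t\ge0$, a vertex $v$ lies in $C(t+1)$ if and only if either $v$ is occupied by a lion at time $t+1$, or $v\in C(t)$ and for every vertex $u$ adjacent to $v$ with $u\notin C(t)$, some lion moves across the edge from $v$ to $u$ between times $t$ and $t+1$. -}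

module Defs where

open import Data.Nat using (ℕ; zero; suc)
open import Data.Fin using (Fin; toℕ)
open import Data.Product using (Σ; ∃; _×_; _,_)
open import Data.Sum using (_⊎_)
open import Relation.Nullary using (¬_)
open import Relation.Binary.PropositionalEquality using (_≡_)

-- Vertices of R_{n,l}: pairs (i , j) with 1 ≤ i ≤ l, 1 ≤ j ≤ n,
-- represented 0-based as Fin l × Fin n.
RVertex : ℕ → ℕ → Set
RVertex n l = Fin l × Fin n

RAdj : (n l : ℕ) → RVertex n l → RVertex n l → Set
RAdj n l (i , j) (i' , j') =
    (toℕ i' ≡ suc (toℕ i) × toℕ j' ≡ toℕ j)
  ⊎ (suc (toℕ i') ≡ toℕ i × toℕ j' ≡ toℕ j)
  ⊎ (toℕ i' ≡ toℕ i × toℕ j' ≡ suc (toℕ j))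
  ⊎ (toℕ i' ≡ toℕ i × suc (toℕ j') ≡ toℕ j)
  ⊎ (toℕ i' ≡ suc (toℕ i) × suc (toℕ j') ≡ toℕ j)
  ⊎ (suc (toℕ i') ≡ toℕ i × toℕ j' ≡ suc (toℕ j))

module LionsGame {V : Set} (Adj : V → V → Set) where

  Strategy : ℕ → Set
  Strategy k = ℕ → Fin k → V

  Legal : {k : ℕ} → Strategy k → Set
  Legal {k} pos = ∀ (t : ℕ) (ℓ : Fin k) →
    pos (suc t) ℓ ≡ pos t ℓ ⊎ Adj (pos t ℓ) (pos (suc t) ℓ)

  Occupied : {k : ℕ} → Strategy k → ℕ → V → Set
  Occupied {k} pos t v = ∃ λ (ℓ : Fin k) → pos t ℓ ≡ v

  MovesAcross : {k : ℕ} → Strategy k → ℕ → V → V → Set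
  MovesAcross {k} pos t v u = ∃ λ (ℓ : Fin k) → pos t ℓ ≡ v × pos (suc t) ℓ ≡ u

  Cleared : {k : ℕ} → Strategy k → ℕ → V → Set
  Cleared pos zero v = Occupied pos zero v
  Cleared pos (suc t) v =
      Occupied pos (suc t) v
    ⊎ (Cleared pos t v ×
       (∀ u → Adj v u → ¬ Cleared pos t u → MovesAcross pos t v u))

Rn : ℕ → Set
Rn n = RVertex n n

RnAdj : (n : ℕ) → Rn n → Rn n → Set
RnAdj n = RAdj n n

-- Write T m = m (m + 1) / 2, so that n² = T n + T (n - 1), and let c t be the number of cleared
-- vertices at time t.  With k ≤ n / 2 lions, c t < T n for all t, by induction: newly cleared
-- vertices are occupied, so c (t + 1) ≤ c t + k, which settles the case c t ≤ T (n - 1).  More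
-- precisely c (t + 1) + |∂C t| ≤ c t + 2k, because a cleared vertex of the inner boundary ∂C t
-- stays cleared only if it is occupied at time t + 1 or a lion stood on it at time t; so c does
-- not grow when |∂C t| ≥ n.  The remaining case T (n - 1) < c t < T n is covered by an
-- isoperimetric inequality for the n × n grid: if |∂S| < n, then S either misses a whole row and
-- a whole column, and then |S| ≤ T |∂S|, or contains a whole row and a whole column, and then its
-- complement has at most T |∂S| vertices.  For the bound, walk from a vertex v of S (of the
-- complement) along its column and along its row towards the empty (full) row and column; the
-- points where the walks leave (enter) S lie on ∂S, and the unordered pair they form determines v.

module Submission where

open import Defs
open import Data.Nat using (ℕ; _≤_; ⌊_/2⌋)
open import Data.Product using (∃)
open import Relation.Nullary using (¬_)

open import Level using (0ℓ)
open import Function using (_∘_; id)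
open import Data.Nat using (zero; suc; _+_; _*_; _<_; z≤n; s≤s)
open import Data.Nat.Properties
open import Data.Nat.Tactic.RingSolver using (solve-∀)
open import Data.Fin using (Fin; toℕ; fromℕ; fromℕ<)
open import Data.Fin.Properties using (toℕ-injective; toℕ<n; toℕ-fromℕ<; any?; all?; ¬∀⟶∃¬)
import Data.Fin.Properties as Fin
open import Data.Product using (∃₂; _×_; _,_; proj₁; proj₂)
open import Data.Product.Properties using (≡-dec)
open import Data.Sum as Sum using (_⊎_; inj₁; inj₂; swap)
open import Data.Empty using (⊥-elim)
open import Data.List using (List; []; _∷_; length; map; _++_; filter; allFin; cartesianProduct)
open import Data.List.Properties using (length-removeAt′; length-map; length-++; length-tabulate; filter-all)
open import Data.List.Membership.Propositional using (_∈_; lose)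
open import Data.List.Membership.Propositional.Properties
  using (∈-map⁺; ∈-++⁺ˡ; ∈-++⁺ʳ; ∈-filter⁺; ∈-filter⁻; ∈-allFin; ∈-cartesianProduct⁺)
open import Data.List.Relation.Unary.Any as Any using (here; there; _─_; satisfied)
open import Data.List.Relation.Unary.All as All using (All)
open import Data.List.Relation.Unary.AllPairs using (_∷_)
open import Data.List.Relation.Unary.Unique.Propositional using (Unique)
import Data.List.Relation.Unary.Unique.Propositional.Properties as Unique
open import Data.List.Relation.Binary.Sublist.Propositional using (⊆-refl)
open import Data.List.Relation.Binary.Sublist.Propositional.Properties using (filter⁺; length-mono-≤)
open import Relation.Binary.PropositionalEquality
open import Relation.Binary.Definitions using (DecidableEquality; tri<; tri≈; tri>)
open import Relation.Nullary using (Dec; yes; no; ¬?; contradiction)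
open import Relation.Nullary.Decidable using (map′; _×-dec_; _⊎-dec_; _→-dec_; decidable-stable)
open import Relation.Unary using (Pred; Decidable; _⊆_; _∪_; _∩_; ∁)
open import Relation.Unary.Properties using (_∪?_; _∩?_; ∁?)

module _ {A : Set} where

  ∈-─⁺ : ∀ {x y} {ys : List A} (y∈ys : y ∈ ys) → x ∈ ys → x ≢ y → x ∈ (ys ─ y∈ys)
  ∈-─⁺ (here refl) (here refl) x≢y = ⊥-elim (x≢y refl)
  ∈-─⁺ (here _)    (there x∈)  _   = x∈
  ∈-─⁺ (there _)   (here refl) _   = here refl
  ∈-─⁺ (there y∈)  (there x∈)  x≢y = there (∈-─⁺ y∈ x∈ x≢y)

module _ {A B : Set} where

  injection⇒length-≤ : (R : A → B → Set) → (∀ {x x′ y} → R x y → R x′ y → x ≡ x′) →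
                       ∀ {xs ys} → Unique xs → (∀ {x} → x ∈ xs → ∃ λ y → y ∈ ys × R x y) →
                       length xs ≤ length ys
  injection⇒length-≤ R R-inj {[]} _ _ = z≤n
  injection⇒length-≤ R R-inj {x ∷ xs} {ys} (x∉xs ∷ unique) image
    with y , y∈ys , Rxy ← image (here refl) = begin
      suc (length xs)         ≤⟨ s≤s (injection⇒length-≤ R R-inj unique image′) ⟩
      suc (length (ys ─ y∈ys)) ≡⟨ length-removeAt′ ys _ ⟨
      length ys               ∎
    where
    open ≤-Reasoning
    image′ : ∀ {x′} → x′ ∈ xs → ∃ λ y′ → y′ ∈ (ys ─ y∈ys) × R x′ y′
    image′ x′∈xs with y′ , y′∈ys , Rx′y′ ← image (there x′∈xs) =
      y′ , ∈-─⁺ y∈ys y′∈ys (λ { refl → All.lookup x∉xs x′∈xs (R-inj Rxy Rx′y′) }) , Rx′y′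

module _ {A : Set} {P Q : Pred A 0ℓ} (P? : Decidable P) (Q? : Decidable Q) where

  length-filter-∪ : ∀ xs → length (filter (P? ∪? Q?) xs) ≤ length (filter P? xs) + length (filter Q? xs)
  length-filter-∪ [] = z≤n
  length-filter-∪ (x ∷ xs) with ih ← length-filter-∪ xs | P? x | Q? x
  ... | yes _ | yes _ = s≤s (≤-trans ih (≤-trans (n≤1+n _) (≤-reflexive (sym (+-suc _ _)))))
  ... | yes _ | no _  = s≤s ih
  ... | no _  | yes _ = ≤-trans (s≤s ih) (≤-reflexive (sym (+-suc _ _)))
  ... | no _  | no _  = ih

  length-filter-∩∁ : ∀ xs →
    length (filter P? xs) ≡ length (filter (P? ∩? Q?) xs) + length (filter (P? ∩? ∁? Q?) xs)
  length-filter-∩∁ [] = refl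
  length-filter-∩∁ (x ∷ xs) with ih ← length-filter-∩∁ xs | P? x | Q? x
  ... | yes _ | yes _ = cong suc ih
  ... | yes _ | no _  = trans (cong suc ih) (sym (+-suc _ _))
  ... | no _  | _     = ih

module _ {A : Set} {P : Pred A 0ℓ} (P? : Decidable P) where

  length-filter+∁ : ∀ xs → length (filter P? xs) + length (filter (∁? P?) xs) ≡ length xs
  length-filter+∁ [] = refl
  length-filter+∁ (x ∷ xs) with ih ← length-filter+∁ xs | P? x
  ... | yes _ = cong suc ih
  ... | no _  = trans (+-suc _ _) (cong suc ih)

length-cartesianProduct : ∀ {A B : Set} (xs : List A) (ys : List B) →
                          length (cartesianProduct xs ys) ≡ length xs * length ys
length-cartesianProduct []       ys = refl
length-cartesianProduct (x ∷ xs) ys = begin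
  length (map (x ,_) ys ++ cartesianProduct xs ys)         ≡⟨ length-++ (map (x ,_) ys) ⟩
  length (map (x ,_) ys) + length (cartesianProduct xs ys) ≡⟨ cong₂ _+_ (length-map (x ,_) ys)
                                                                        (length-cartesianProduct xs ys) ⟩
  length ys + length xs * length ys                        ∎
  where open ≡-Reasoning

triangular : ℕ → ℕ
triangular zero    = 0
triangular (suc m) = suc m + triangular m

triangular-mono-≤ : ∀ {m n} → m ≤ n → triangular m ≤ triangular n
triangular-mono-≤ {zero}  _         = z≤n
triangular-mono-≤ {suc m} (s≤s m≤n) = +-mono-≤ (s≤s m≤n) (triangular-mono-≤ m≤n)

triangular-suc+triangular : ∀ m → triangular (suc m) + triangular m ≡ suc m * suc m
triangular-suc+triangular zero    = refl
triangular-suc+triangular (suc m) = begin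
  (suc (suc m) + triangular (suc m)) + (suc m + triangular m) ≡⟨ regroup (suc (suc m)) _ (suc m) _ ⟩
  (suc (suc m) + suc m) + (triangular (suc m) + triangular m) ≡⟨ cong (suc (suc m) + suc m +_)
                                                                      (triangular-suc+triangular m) ⟩
  (suc (suc m) + suc m) + suc m * suc m                       ≡⟨ square-suc m ⟩
  suc (suc m) * suc (suc m)                                   ∎
  where
  open ≡-Reasoning
  regroup : ∀ a b c d → (a + b) + (c + d) ≡ (a + c) + (b + d)
  regroup = solve-∀
  square-suc : ∀ m → (suc (suc m) + suc m) + suc m * suc m ≡ suc (suc m) * suc (suc m)
  square-suc = solve-∀

module _ {A : Set} where

  unorderedPairs : List A → List (A × A)
  unorderedPairs []       = []
  unorderedPairs (x ∷ xs) = map (x ,_) (x ∷ xs) ++ unorderedPairs xs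

  length-unorderedPairs : ∀ xs → length (unorderedPairs xs) ≡ triangular (length xs)
  length-unorderedPairs []       = refl
  length-unorderedPairs (x ∷ xs) = begin
    length (map (x ,_) (x ∷ xs) ++ unorderedPairs xs)         ≡⟨ length-++ (map (x ,_) (x ∷ xs)) ⟩
    length (map (x ,_) (x ∷ xs)) + length (unorderedPairs xs) ≡⟨ cong₂ _+_ (length-map (x ,_) (x ∷ xs))
                                                                          (length-unorderedPairs xs) ⟩
    suc (length xs) + triangular (length xs)                  ∎
    where open ≡-Reasoning

  ∈-unorderedPairs : ∀ {a b xs} → a ∈ xs → b ∈ xs →
                     (a , b) ∈ unorderedPairs xs ⊎ (b , a) ∈ unorderedPairs xs
  ∈-unorderedPairs {xs = x ∷ xs} (here refl) b∈ = inj₁ (∈-++⁺ˡ (∈-map⁺ (x ,_) b∈))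
  ∈-unorderedPairs {xs = x ∷ xs} (there a∈) (here refl) = inj₂ (∈-++⁺ˡ (∈-map⁺ (x ,_) (there a∈)))
  ∈-unorderedPairs {xs = x ∷ xs} (there a∈) (there b∈) =
    Sum.map (∈-++⁺ʳ (map (x ,_) (x ∷ xs))) (∈-++⁺ʳ (map (x ,_) (x ∷ xs))) (∈-unorderedPairs a∈ b∈)

module Enumeration {A : Set} (elements : List A) (complete : ∀ x → x ∈ elements) (unique : Unique elements) where

  ∃? : {P : Pred A 0ℓ} → Decidable P → Dec (∃ P)
  ∃? P? = map′ satisfied (λ (x , Px) → lose (complete x) Px) (Any.any? P? elements)

  ∀? : {P : Pred A 0ℓ} → Decidable P → Dec (∀ x → P x)
  ∀? P? = map′ (λ all x → All.lookup all (complete x)) (λ ∀P → All.tabulate (λ {x} _ → ∀P x))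
               (All.all? P? elements)

  ∣_∣ : {P : Pred A 0ℓ} → Decidable P → ℕ
  ∣ P? ∣ = length (filter P? elements)

  module _ {P Q : Pred A 0ℓ} (P? : Decidable P) (Q? : Decidable Q) where

    ∣∣-mono-≤ : P ⊆ Q → ∣ P? ∣ ≤ ∣ Q? ∣
    ∣∣-mono-≤ P⊆Q = length-mono-≤ (filter⁺ P? Q? (λ { refl → P⊆Q }) (⊆-refl {x = elements}))

  module _ {P : Pred A 0ℓ} (P? : Decidable P) where

    ∣∣+∣∁∣ : ∣ P? ∣ + ∣ ∁? P? ∣ ≡ length elements
    ∣∣+∣∁∣ = length-filter+∁ P? elements

    ∣∣-full : (∀ x → P x) → ∣ P? ∣ ≡ length elements
    ∣∣-full ∀P = cong length (filter-all P? {elements} (All.tabulate (λ {x} _ → ∀P x)))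

    surjective⇒length≤∣∣ : {B : Set} (f : A → B) {ys : List B} → Unique ys →
                           (∀ {y} → y ∈ ys → ∃ λ x → P x × f x ≡ y) → length ys ≤ ∣ P? ∣
    surjective⇒length≤∣∣ f unique-ys preimage =
      injection⇒length-≤ (λ y x → f x ≡ y) (λ fx≡y fx≡y′ → trans (sym fx≡y) fx≡y′) unique-ys
        (λ y∈ys → let x , Px , fx≡y = preimage y∈ys in x , ∈-filter⁺ P? (complete x) Px , fx≡y)

  module _ {X B : Pred A 0ℓ} (X? : Decidable X) (B? : Decidable B) (Q : A → A → A → Set) where

    ∣∣≤triangular-by-pairs : (∀ {x} → X x → ∃₂ λ a b → B a × B b × Q x a b) →
                             (∀ {x x′ a b} → Q x a b → Q x′ a b ⊎ Q x′ b a → x ≡ x′) →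
                             ∣ X? ∣ ≤ triangular ∣ B? ∣
    ∣∣≤triangular-by-pairs pair determines = subst (∣ X? ∣ ≤_) (length-unorderedPairs (filter B? elements))
      (injection⇒length-≤ R R-injective (Unique.filter⁺ X? {elements} unique) image)
      where
      R : A → A × A → Set
      R x (a , b) = Q x a b ⊎ Q x b a
      R-injective : ∀ {x x′ ab} → R x ab → R x′ ab → x ≡ x′
      R-injective (inj₁ q) r′ = determines q r′
      R-injective (inj₂ q) r′ = determines q (swap r′)
      image : ∀ {x} → x ∈ filter X? elements → ∃ λ ab → ab ∈ unorderedPairs (filter B? elements) × R x ab
      image x∈ with a , b , Ba , Bb , q ← pair (proj₂ (∈-filter⁻ X? {xs = elements} x∈))
                  | ∈-unorderedPairs (∈-filter⁺ B? (complete a) Ba) (∈-filter⁺ B? (complete b) Bb)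
      ... | inj₁ ab∈ = (a , b) , ab∈ , inj₁ q
      ... | inj₂ ba∈ = (b , a) , ba∈ , inj₂ q

Between : ℕ → ℕ → ℕ → Set
Between a c x = (a ≤ x × x < c) ⊎ (c < x × x ≤ a)

Between-shared-end : ∀ {a b c} → Between a c b → Between b c a → a ≡ b
Between-shared-end (inj₁ (a≤b , _))   (inj₁ (b≤a , _))   = ≤-antisym a≤b b≤a
Between-shared-end (inj₁ (a≤b , b<c)) (inj₂ (c<a , _))   = ⊥-elim (n≮n _ (<-trans c<a (≤-<-trans a≤b b<c)))
Between-shared-end (inj₂ (c<b , b≤a)) (inj₁ (_ , a<c))   = ⊥-elim (n≮n _ (<-trans c<b (≤-<-trans b≤a a<c)))
Between-shared-end (inj₂ (_ , b≤a))   (inj₂ (_ , a≤b))   = ≤-antisym a≤b b≤a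

Between-shared-start : ∀ {a b c} → Between c a b → Between c b a → a ≡ b
Between-shared-start (inj₁ (_ , b<a))   (inj₁ (_ , a<b))   = ⊥-elim (n≮n _ (<-trans a<b b<a))
Between-shared-start (inj₁ (c≤b , b<a)) (inj₂ (_ , a≤c))   = ⊥-elim (n≮n _ (<-≤-trans b<a (≤-trans a≤c c≤b)))
Between-shared-start (inj₂ (a<b , b≤c)) (inj₁ (c≤a , _))   = ⊥-elim (n≮n _ (<-≤-trans a<b (≤-trans b≤c c≤a)))
Between-shared-start (inj₂ (a<b , _))   (inj₂ (b<a , _))   = ⊥-elim (n≮n _ (<-trans a<b b<a))

Between⇒< : ∀ {a c x n} → a < n → c < n → Between a c x → x < n
Between⇒< _   c<n (inj₁ (_ , x<c)) = <-trans x<c c<n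
Between⇒< a<n _   (inj₂ (_ , x≤a)) = ≤-<-trans x≤a a<n

switch-point : ∀ {P : Pred ℕ 0ℓ} → Decidable P → ∀ {a c} → a ≤ c → P a → ¬ P c →
               ∃ λ x → a ≤ x × x < c × P x × ¬ P (suc x)
switch-point P? a≤c Pa ¬Pc with m≤n⇒m<n∨m≡n a≤c
... | inj₂ refl = contradiction Pa ¬Pc
switch-point P? {c = suc c} _ Pa ¬Psc | inj₁ (s≤s a≤c) with P? c
... | yes Pc  = c , a≤c , ≤-refl , Pc , ¬Psc
... | no ¬Pc with x , a≤x , x<c , Px , ¬Psx ← switch-point P? a≤c Pa ¬Pc =
  x , a≤x , m<n⇒m<1+n x<c , Px , ¬Psx

module Graph {V : Set} (Adj : V → V → Set) where

  Boundary : Pred V 0ℓ → Pred V 0ℓ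
  Boundary S v = S v × ∃ λ u → Adj v u × ¬ S u

  boundary-between : ∀ {S : Pred V 0ℓ} → Decidable S → (L : ℕ → V) {n : ℕ} →
                     (∀ {x} → suc x < n → Adj (L x) (L (suc x)) × Adj (L (suc x)) (L x)) →
                     ∀ {a c} → a < n → c < n → S (L a) → ¬ S (L c) →
                     ∃ λ x → Between a c x × Boundary S (L x)
  boundary-between {S} S? L step {a} {c} a<n c<n SLa ¬SLc with <-cmp a c
  ... | tri< a<c _ _ with x , a≤x , x<c , SLx , ¬SLsx ← switch-point (S? ∘ L) (<⇒≤ a<c) SLa ¬SLc =
    x , inj₁ (a≤x , x<c) , SLx , L (suc x) , proj₁ (step (≤-<-trans x<c c<n)) , ¬SLsx
  ... | tri≈ _ refl _ = contradiction SLa ¬SLc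
  ... | tri> _ _ c<a
    with y , c≤y , y<a , ¬SLy , ¬¬SLsy ← switch-point (∁? (S? ∘ L)) (<⇒≤ c<a) ¬SLc (λ ¬SLa → ¬SLa SLa) =
    suc y , inj₂ (s≤s c≤y , y<a) , decidable-stable (S? (L (suc y))) ¬¬SLsy ,
    L y , proj₂ (step (≤-<-trans y<a a<n)) , ¬SLy

module FiniteLionsGame {V : Set} (_≟_ : DecidableEquality V)
                       {Adj : V → V → Set} (Adj? : ∀ v u → Dec (Adj v u))
                       (vertices : List V) (complete : ∀ v → v ∈ vertices) (unique : Unique vertices) where

  open LionsGame Adj
  open Graph Adj
  open Enumeration vertices complete unique

  Boundary? : ∀ {S : Pred V 0ℓ} → Decidable S → Decidable (Boundary S)
  Boundary? S? v = S? v ×-dec ∃? (λ u → Adj? v u ×-dec ¬? (S? u))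

  module _ {k : ℕ} (pos : Strategy k) where

    Occupied? : ∀ t → Decidable (Occupied pos t)
    Occupied? t v = any? (λ ℓ → pos t ℓ ≟ v)

    MovesAcross? : ∀ t v → Decidable (MovesAcross pos t v)
    MovesAcross? t v u = any? (λ ℓ → (pos t ℓ ≟ v) ×-dec (pos (suc t) ℓ ≟ u))

    Cleared? : ∀ t → Decidable (Cleared pos t)
    Cleared? zero      = Occupied? zero
    Cleared? (suc t) v = Occupied? (suc t) v ⊎-dec
      (Cleared? t v ×-dec ∀? (λ u → Adj? v u →-dec ¬? (Cleared? t u) →-dec MovesAcross? t v u))

    ∣Occupied∣≤k : ∀ t → ∣ Occupied? t ∣ ≤ k
    ∣Occupied∣≤k t = subst (∣ Occupied? t ∣ ≤_) (length-tabulate id)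
      (injection⇒length-≤ (λ v ℓ → pos t ℓ ≡ v) (λ ℓ↦v ℓ↦v′ → trans (sym ℓ↦v) ℓ↦v′)
        (Unique.filter⁺ (Occupied? t) {vertices} unique)
        (λ v∈ → let ℓ , ℓ↦v = proj₂ (∈-filter⁻ (Occupied? t) {xs = vertices} v∈)
                in ℓ , ∈-allFin ℓ , ℓ↦v))

    ∣Cleared-suc∣≤∣Cleared∣+k : ∀ t → ∣ Cleared? (suc t) ∣ ≤ ∣ Cleared? t ∣ + k
    ∣Cleared-suc∣≤∣Cleared∣+k t = begin
      ∣ Cleared? (suc t) ∣                   ≤⟨ ∣∣-mono-≤ (Cleared? (suc t)) _ stays ⟩
      ∣ Occupied? (suc t) ∪? Cleared? t ∣    ≤⟨ length-filter-∪ (Occupied? (suc t)) (Cleared? t) vertices ⟩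
      ∣ Occupied? (suc t) ∣ + ∣ Cleared? t ∣ ≤⟨ +-monoˡ-≤ _ (∣Occupied∣≤k (suc t)) ⟩
      k + ∣ Cleared? t ∣                     ≡⟨ +-comm k _ ⟩
      ∣ Cleared? t ∣ + k                     ∎
      where
      open ≤-Reasoning
      stays : Cleared pos (suc t) ⊆ Occupied pos (suc t) ∪ Cleared pos t
      stays (inj₁ occupied)      = inj₁ occupied
      stays (inj₂ (cleared , _)) = inj₂ cleared

    ∣Cleared-suc∣+∣∂Cleared∣≤∣Cleared∣+2k : ∀ t →
      ∣ Cleared? (suc t) ∣ + ∣ Boundary? (Cleared? t) ∣ ≤ ∣ Cleared? t ∣ + (k + k)
    ∣Cleared-suc∣+∣∂Cleared∣≤∣Cleared∣+2k t = begin
      ∣ Cleared? (suc t) ∣ + ∣ ∂C? ∣           ≤⟨ +-mono-≤ next≤ (∣∣-mono-≤ ∂C? (C? ∩? ∂C?) (λ ∂C → proj₁ ∂C , ∂C)) ⟩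
      k + (∣ Interior? ∣ + k) + ∣ C? ∩? ∂C? ∣   ≡⟨ rearrange k _ _ ⟩
      (∣ C? ∩? ∂C? ∣ + ∣ Interior? ∣) + (k + k) ≡⟨ cong (_+ (k + k)) (length-filter-∩∁ C? ∂C? vertices) ⟨
      ∣ C? ∣ + (k + k)                         ∎
      where
      open ≤-Reasoning
      C? : Decidable (Cleared pos t)
      C? = Cleared? t
      ∂C? : Decidable (Boundary (Cleared pos t))
      ∂C? = Boundary? C?
      Interior? : Decidable (Cleared pos t ∩ ∁ (Boundary (Cleared pos t)))
      Interior? = C? ∩? ∁? ∂C?
      next⊆ : Cleared pos (suc t) ⊆
              Occupied pos (suc t) ∪ ((Cleared pos t ∩ ∁ (Boundary (Cleared pos t))) ∪ Occupied pos t)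
      next⊆ (inj₁ occupied) = inj₁ occupied
      next⊆ {v} (inj₂ (cleared , guarded)) with ∂C? v
      ... | no ¬boundary = inj₂ (inj₁ (cleared , ¬boundary))
      ... | yes (_ , u , v~u , ¬cleared-u) with ℓ , at-v , _ ← guarded u v~u ¬cleared-u = inj₂ (inj₂ (ℓ , at-v))
      next≤ : ∣ Cleared? (suc t) ∣ ≤ k + (∣ Interior? ∣ + k)
      next≤ = begin
        ∣ Cleared? (suc t) ∣                                ≤⟨ ∣∣-mono-≤ (Cleared? (suc t)) _ next⊆ ⟩
        ∣ Occupied? (suc t) ∪? (Interior? ∪? Occupied? t) ∣ ≤⟨ length-filter-∪ (Occupied? (suc t)) _ vertices ⟩
        ∣ Occupied? (suc t) ∣ + ∣ Interior? ∪? Occupied? t ∣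
          ≤⟨ +-monoʳ-≤ _ (length-filter-∪ Interior? (Occupied? t) vertices) ⟩
        ∣ Occupied? (suc t) ∣ + (∣ Interior? ∣ + ∣ Occupied? t ∣)
          ≤⟨ +-mono-≤ (∣Occupied∣≤k (suc t)) (+-monoʳ-≤ _ (∣Occupied∣≤k t)) ⟩
        k + (∣ Interior? ∣ + k)                            ∎
      rearrange : ∀ k a d → k + (a + k) + d ≡ (d + a) + (k + k)
      rearrange = solve-∀

RAdj? : ∀ n l (v u : RVertex n l) → Dec (RAdj n l v u)
RAdj? n l (i , j) (i′ , j′) =
      (toℕ i′ ≟ suc (toℕ i) ×-dec toℕ j′ ≟ toℕ j)
  ⊎-dec (suc (toℕ i′) ≟ toℕ i ×-dec toℕ j′ ≟ toℕ j)
  ⊎-dec (toℕ i′ ≟ toℕ i ×-dec toℕ j′ ≟ suc (toℕ j))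
  ⊎-dec (toℕ i′ ≟ toℕ i ×-dec suc (toℕ j′) ≟ toℕ j)
  ⊎-dec (toℕ i′ ≟ suc (toℕ i) ×-dec suc (toℕ j′) ≟ toℕ j)
  ⊎-dec (suc (toℕ i′) ≟ toℕ i ×-dec toℕ j′ ≟ suc (toℕ j))
  where open Data.Nat using (_≟_)

module Rhombus (p : ℕ) where

  n : ℕ
  n = suc p

  vertices : List (Rn n)
  vertices = cartesianProduct (allFin n) (allFin n)

  complete : ∀ v → v ∈ vertices
  complete (i , j) = ∈-cartesianProduct⁺ (∈-allFin i) (∈-allFin j)

  unique : Unique vertices
  unique = Unique.cartesianProduct⁺ (Unique.allFin⁺ n) (Unique.allFin⁺ n)

  length-vertices : length vertices ≡ n * n
  length-vertices = trans (length-cartesianProduct (allFin n) (allFin n))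
                          (cong₂ _*_ length-allFin length-allFin)
    where
    length-allFin : length (allFin n) ≡ n
    length-allFin = length-tabulate id

  open Graph (RnAdj n) public
  open Enumeration vertices complete unique public
  open FiniteLionsGame (≡-dec Fin._≟_ Fin._≟_) (RAdj? n n) vertices complete unique public

  clamp : ℕ → Fin n
  clamp x with x <? n
  ... | yes x<n = fromℕ< x<n
  ... | no _    = fromℕ p

  toℕ-clamp : ∀ {x} → x < n → toℕ (clamp x) ≡ x
  toℕ-clamp {x} x<n with x <? n
  ... | yes x<n′ = toℕ-fromℕ< x<n′
  ... | no x≮n   = contradiction x<n x≮n

  clamp-toℕ : ∀ i → clamp (toℕ i) ≡ i
  clamp-toℕ i = toℕ-injective (toℕ-clamp (toℕ<n i))

  Straight : (Fin n → Rn n) → Set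
  Straight L = ∀ {x y} → suc (toℕ x) ≡ toℕ y → RnAdj n (L x) (L y) × RnAdj n (L y) (L x)

  row column : Fin n → Fin n → Rn n
  row i j    = i , j
  column j i = i , j

  row-straight : ∀ i → Straight (row i)
  row-straight i x→y = inj₂ (inj₂ (inj₁ (refl , sym x→y))) , inj₂ (inj₂ (inj₂ (inj₁ (refl , x→y))))

  column-straight : ∀ j → Straight (column j)
  column-straight j x→y = inj₁ (sym x→y , refl) , inj₂ (inj₁ (x→y , refl))

  straight-clamp : ∀ {L} → Straight L → ∀ {z} → suc z < n →
                   RnAdj n (L (clamp z)) (L (clamp (suc z))) × RnAdj n (L (clamp (suc z))) (L (clamp z))
  straight-clamp straight {z} sz<n =
    straight (trans (cong suc (toℕ-clamp (<-trans (n<1+n z) sz<n))) (sym (toℕ-clamp sz<n)))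

  module _ {S : Pred (Rn n) 0ℓ} (S? : Decidable S) where

    boundary-on-line : ∀ {L} → Straight L → ∀ {x y} → S (L x) → ¬ S (L y) →
                       ∃ λ z → Between (toℕ x) (toℕ y) (toℕ z) × Boundary S (L z)
    boundary-on-line {L} straight {x} {y} SLx ¬SLy
      with z , between , ∂Sz ← boundary-between S? (L ∘ clamp) (straight-clamp straight) (toℕ<n x) (toℕ<n y)
                                 (subst (S ∘ L) (sym (clamp-toℕ x)) SLx)
                                 (subst (∁ S ∘ L) (sym (clamp-toℕ y)) ¬SLy)
      = clamp z , subst (Between (toℕ x) (toℕ y)) (sym (toℕ-clamp z<n)) between , ∂Sz
      where
      z<n : z < n
      z<n = Between⇒< (toℕ<n x) (toℕ<n y) between

    Mixed : (Fin n → Rn n) → Set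
    Mixed L = ∃ (S ∘ L) × ∃ (∁ S ∘ L)

    Mixed? : ∀ L → Dec (Mixed L)
    Mixed? L = any? (S? ∘ L) ×-dec any? (∁? S? ∘ L)

    uniform-unless-mixed : ∀ L → ¬ Mixed L → (∀ z → S (L z)) ⊎ (∀ z → ¬ S (L z))
    uniform-unless-mixed L ¬mixed with all? (S? ∘ L)
    ... | yes full = inj₁ full
    ... | no ¬full = inj₂ (λ z SLz → ¬mixed ((z , SLz) , ¬∀⟶∃¬ n (S ∘ L) (S? ∘ L) ¬full))

    mixed-lines⇒n≤∣∂S∣ : (line : Fin n → Fin n → Rn n) → (∀ i → Straight (line i)) →
                         (π : Rn n → Fin n) → (∀ i z → π (line i z) ≡ i) →
                         (∀ i → Mixed (line i)) → n ≤ ∣ Boundary? S? ∣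
    mixed-lines⇒n≤∣∂S∣ line straight π π-line mixed =
      subst (_≤ ∣ Boundary? S? ∣) (length-tabulate id)
            (surjective⇒length≤∣∣ (Boundary? S?) π (Unique.allFin⁺ n) crossing)
      where
      crossing : ∀ {i} → i ∈ allFin n → ∃ λ v → Boundary S v × π v ≡ i
      crossing {i} _ with (_ , Sx) , (_ , ¬Sy) ← mixed i with z , _ , ∂Sz ← boundary-on-line (straight i) Sx ¬Sy =
        line i z , ∂Sz , π-line i z

  module _ {X B : Pred (Rn n) 0ℓ} (X? : Decidable X) (B? : Decidable B) (I J : ℕ → ℕ → Set)
           (I-antisym : ∀ {r r′} → I r r′ → I r′ r → r ≡ r′)
           (J-antisym : ∀ {c c′} → J c c′ → J c′ c → c ≡ c′) where

    ∣∣≤triangular-by-row-column-pairs :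
      (∀ {i j} → X (i , j) → ∃ λ i′ → I (toℕ i) (toℕ i′) × B (i′ , j)) →
      (∀ {i j} → X (i , j) → ∃ λ j′ → J (toℕ j) (toℕ j′) × B (i , j′)) →
      ∣ X? ∣ ≤ triangular ∣ B? ∣
    ∣∣≤triangular-by-row-column-pairs in-column in-row = ∣∣≤triangular-by-pairs X? B? Q pair determines
      where
      Q : Rn n → Rn n → Rn n → Set
      Q (i , j) (i₁ , j₁) (i₂ , j₂) = j₁ ≡ j × I (toℕ i) (toℕ i₁) × i₂ ≡ i × J (toℕ j) (toℕ j₂)
      pair : ∀ {v} → X v → ∃ λ a → ∃ λ b → B a × B b × Q v a b
      pair {i , j} Xv with i′ , Iii′ , Ba ← in-column Xv | j′ , Jjj′ , Bb ← in-row Xv =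
        (i′ , j) , (i , j′) , Ba , Bb , refl , Iii′ , refl , Jjj′
      determines : ∀ {v v′ a b} → Q v a b → Q v′ a b ⊎ Q v′ b a → v ≡ v′
      determines (refl , _ , refl , _) (inj₁ (refl , _ , refl , _)) = refl
      determines (refl , Iii′ , refl , Jjj′) (inj₂ (refl , Ii′i , refl , Jj′j)) =
        cong₂ _,_ (toℕ-injective (I-antisym Iii′ Ii′i)) (toℕ-injective (J-antisym Jjj′ Jj′j))

  module _ {S : Pred (Rn n) 0ℓ} (S? : Decidable S) where

    empty-cross⇒∣S∣≤triangular∣∂S∣ : ∀ {i₁ j₁} → (∀ j → ¬ S (i₁ , j)) → (∀ i → ¬ S (i , j₁)) →
                                     ∣ S? ∣ ≤ triangular ∣ Boundary? S? ∣
    empty-cross⇒∣S∣≤triangular∣∂S∣ {i₁} {j₁} empty-row empty-column =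
      ∣∣≤triangular-by-row-column-pairs S? (Boundary? S?)
        (λ r r′ → Between r (toℕ i₁) r′) (λ c c′ → Between c (toℕ j₁) c′)
        Between-shared-end Between-shared-end
        (λ {_} {j} Sij → boundary-on-line S? (column-straight j) Sij (empty-row j))
        (λ {i} Sij → boundary-on-line S? (row-straight i) Sij (empty-column i))

    full-cross⇒∣∁S∣≤triangular∣∂S∣ : ∀ {i₀ j₀} → (∀ j → S (i₀ , j)) → (∀ i → S (i , j₀)) →
                                     ∣ ∁? S? ∣ ≤ triangular ∣ Boundary? S? ∣
    full-cross⇒∣∁S∣≤triangular∣∂S∣ {i₀} {j₀} full-row full-column =
      ∣∣≤triangular-by-row-column-pairs (∁? S?) (Boundary? S?)
        (λ r r′ → Between (toℕ i₀) r r′) (λ c c′ → Between (toℕ j₀) c c′)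
        Between-shared-start Between-shared-start
        (λ {_} {j} ¬Sij → boundary-on-line S? (column-straight j) (full-row j) ¬Sij)
        (λ {i} ¬Sij → boundary-on-line S? (row-straight i) (full-column i) ¬Sij)

    isoperimetric : n ≤ ∣ Boundary? S? ∣
                  ⊎ ∣ S? ∣ ≤ triangular ∣ Boundary? S? ∣
                  ⊎ ∣ ∁? S? ∣ ≤ triangular ∣ Boundary? S? ∣
    isoperimetric with all? (Mixed? S? ∘ row) | all? (Mixed? S? ∘ column)
    ... | yes rows-mixed | _ =
      inj₁ (mixed-lines⇒n≤∣∂S∣ S? row row-straight proj₁ (λ _ _ → refl) rows-mixed)
    ... | no _ | yes columns-mixed =
      inj₁ (mixed-lines⇒n≤∣∂S∣ S? column column-straight proj₂ (λ _ _ → refl) columns-mixed)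
    ... | no ¬rows-mixed | no ¬columns-mixed
      with i , ¬mixed-i ← ¬∀⟶∃¬ n _ (Mixed? S? ∘ row) ¬rows-mixed
         | j , ¬mixed-j ← ¬∀⟶∃¬ n _ (Mixed? S? ∘ column) ¬columns-mixed
      with uniform-unless-mixed S? (row i) ¬mixed-i | uniform-unless-mixed S? (column j) ¬mixed-j
    ... | inj₁ full-i  | inj₁ full-j  = inj₂ (inj₂ (full-cross⇒∣∁S∣≤triangular∣∂S∣ full-i full-j))
    ... | inj₂ empty-i | inj₂ empty-j = inj₂ (inj₁ (empty-cross⇒∣S∣≤triangular∣∂S∣ empty-i empty-j))
    ... | inj₁ full-i  | inj₂ empty-j = contradiction (full-i j) (empty-j i)
    ... | inj₂ empty-i | inj₁ full-j  = contradiction (full-j i) (empty-i j)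

    ∣∣+∣∁∣≡triangular+triangular : ∣ S? ∣ + ∣ ∁? S? ∣ ≡ triangular n + triangular p
    ∣∣+∣∁∣≡triangular+triangular =
      trans (∣∣+∣∁∣ S?) (trans length-vertices (sym (triangular-suc+triangular p)))

    medium⇒n≤∣∂S∣ : triangular p < ∣ S? ∣ → ∣ S? ∣ < triangular n → n ≤ ∣ Boundary? S? ∣
    medium⇒n≤∣∂S∣ above below with isoperimetric
    ... | inj₁ n≤∣∂S∣      = n≤∣∂S∣
    ... | inj₂ (inj₁ small) = ≰⇒> λ ∣∂S∣≤p → <⇒≱ above (≤-trans small (triangular-mono-≤ ∣∂S∣≤p))
    ... | inj₂ (inj₂ small) = ≰⇒> λ ∣∂S∣≤p → <⇒≱ below (+-cancelʳ-≤ (triangular p) _ _ (begin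
      triangular n + triangular p ≡⟨ ∣∣+∣∁∣≡triangular+triangular ⟨
      ∣ S? ∣ + ∣ ∁? S? ∣           ≤⟨ +-monoʳ-≤ ∣ S? ∣ (≤-trans small (triangular-mono-≤ ∣∂S∣≤p)) ⟩
      ∣ S? ∣ + triangular p        ∎))
      where open ≤-Reasoning

  open LionsGame (RnAdj n) using (Strategy; Cleared)

  module _ {k : ℕ} (pos : Strategy k) (k<n : k < n) (k+k≤n : k + k ≤ n) where

    ∣Cleared∣<triangular : ∀ t → ∣ Cleared? pos t ∣ < triangular n
    ∣Cleared∣<triangular zero = ≤-<-trans (∣Occupied∣≤k pos zero) (<-≤-trans k<n (m≤m+n n (triangular p)))
    ∣Cleared∣<triangular (suc t) with ∣ Cleared? pos t ∣ ≤? triangular p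
    ... | yes small = begin-strict
      ∣ Cleared? pos (suc t) ∣ ≤⟨ ∣Cleared-suc∣≤∣Cleared∣+k pos t ⟩
      ∣ Cleared? pos t ∣ + k   ≤⟨ +-monoˡ-≤ k small ⟩
      triangular p + k         <⟨ +-monoʳ-< (triangular p) k<n ⟩
      triangular p + n         ≡⟨ +-comm (triangular p) n ⟩
      triangular n             ∎
      where open ≤-Reasoning
    ... | no ¬small = ≤-<-trans no-growth (∣Cleared∣<triangular t)
      where
      open ≤-Reasoning
      n≤∣∂C∣ : n ≤ ∣ Boundary? (Cleared? pos t) ∣
      n≤∣∂C∣ = medium⇒n≤∣∂S∣ (Cleared? pos t) (≰⇒> ¬small) (∣Cleared∣<triangular t)
      no-growth : ∣ Cleared? pos (suc t) ∣ ≤ ∣ Cleared? pos t ∣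
      no-growth = +-cancelʳ-≤ ∣ Boundary? (Cleared? pos t) ∣ _ _ (begin
        ∣ Cleared? pos (suc t) ∣ + ∣ Boundary? (Cleared? pos t) ∣
          ≤⟨ ∣Cleared-suc∣+∣∂Cleared∣≤∣Cleared∣+2k pos t ⟩
        ∣ Cleared? pos t ∣ + (k + k)
          ≤⟨ +-monoʳ-≤ _ (≤-trans k+k≤n n≤∣∂C∣) ⟩
        ∣ Cleared? pos t ∣ + ∣ Boundary? (Cleared? pos t) ∣ ∎)

    never-cleared : ∀ t → ¬ (∀ v → Cleared pos t v)
    never-cleared t all-cleared = <⇒≱ (∣Cleared∣<triangular t) (begin
      triangular n                  ≤⟨ m≤m+n (triangular n) (triangular p) ⟩
      triangular n + triangular p   ≡⟨ triangular-suc+triangular p ⟩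
      n * n                         ≡⟨ length-vertices ⟨
      length vertices               ≡⟨ ∣∣-full (Cleared? pos t) all-cleared ⟨
      ∣ Cleared? pos t ∣            ∎)
      where open ≤-Reasoning

⌊n/2⌋+⌊n/2⌋≤n : ∀ n → ⌊ n /2⌋ + ⌊ n /2⌋ ≤ n
⌊n/2⌋+⌊n/2⌋≤n n = ≤-trans (+-monoʳ-≤ ⌊ n /2⌋ (⌊n/2⌋≤⌈n/2⌉ n)) (≤-reflexive (⌊n/2⌋+⌈n/2⌉≡n n))

mainTheorem4 : (n : ℕ) → 1 ≤ n → (pos : LionsGame.Strategy (RnAdj n) ⌊ n /2⌋) →
    LionsGame.Legal (RnAdj n) pos →
    ¬ (∃ λ (t : ℕ) → ∀ (v : Rn n) → LionsGame.Cleared (RnAdj n) pos t v)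
mainTheorem4 zero () _ _
mainTheorem4 (suc p) _ pos _ (t , all-cleared) =
  Rhombus.never-cleared p pos (⌊n/2⌋<n p) (⌊n/2⌋+⌊n/2⌋≤n (suc p)) t all-cleared
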